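{- Let $P$ be a finite connected poset such that $J(P)$ is tCDE with edge density $c$. Then the antichain cardinality statistic $I\mapsto\#\max(I)$ is $c$-mesic with respect to the action of $\Phi_{\mathrm{row}}$ on $J(P)$. If $P$ is ranked, the antichain cardinality statistic is also $c$-mesic with respect to the action of $\Phi_{\mathrm{row}(\sigma)}$ on $J(P)$ for every permutation $\sigma$ of the ranks of $P$.
   Context: $J(P)$ is the set of order ideals of $P$ ordered by inclusion. Rowmotion: $\Phi_{\mathrm{row}}(I):=\{x\in P: x\le y\text{ for some } y\in\min(P\setminus I)\}$. $P$ is ranked if there is $\mathrm{rk}:P\to\mathbb{N}$ with 0 in its image and $\mathrm{rk}(q)=\mathrm{rk}(p)+1$ whenever $q$ covers $p$; ranks are $0,\dots,r$. Toggle $\tau_p(I)$: $I\cup\{p\}$ if $p\notin I$ and $p$ minimal in $P\setminus I$; $I\setminus\{p\}$ if $p\in I$ maximal in $I$; $I$ otherwise. $\tau_i$ composes all $\tau_p$ with $\mathrm{rk}(p)=i$; $\Phi_{\mathrm{row}(\sigma)}:=\tau_{\sigma(0)}\circ\cdots\circ\tau_{\sigma(r)}$. $\mathcal{T}^\pm_p(I)\in\{0,1\}$ indicate whether $p$ can be toggled into/out of $I$; a distribution $\mu$ on $J(P)$ is toggle-symmetric if $\mathbb{E}(\mu;\mathcal{T}^+_p)=\mathbb{E}(\mu;\mathcal{T}^-_p)$ for all $p$. $\mathrm{ddeg}(I)$ is the number of elements covered by $I$; $J(P)$ is tCDE with edge density $c$ if $\mathbb{E}(\mu;\mathrm{ddeg})=\mathbb{E}(\mathrm{uni};\mathrm{ddeg})=c$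 for every toggle-symmetric $\mu$, $\mathrm{uni}$ uniform. A statistic $f$ on a finite set is $c$-mesic with respect to an invertible map $\Phi$ if the average of $f$ over every $\Phi$-orbit equals $c$. -}

module Defs where

open import Data.Nat as ℕ using (ℕ; zero; suc)
open import Data.Bool using (Bool; true; false; _∧_; _∨_; not; if_then_else_)
open import Data.Fin using (Fin; toℕ)
open import Data.Fin.Subset using (Subset)
open import Data.Fin.Permutation using (Permutation′; _⟨$⟩ʳ_)
open import Data.Vec using (Vec; []; _∷_; lookup; tabulate; _[_]≔_)
open import Data.List as List using (List; []; _∷_; _++_)
open import Data.Product using (Σ; ∃; _×_; _,_)
open import Data.Sum using (_⊎_)
open import Data.Integer using (+_)
open import Data.Rational as ℚ using (ℚ; 0ℚ; 1ℚ; _/_)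
open import Relation.Binary using (Rel; Decidable; IsPartialOrder)
open import Relation.Binary.PropositionalEquality using (_≡_; _≢_)
open import Relation.Nullary using (¬_)
open import Relation.Nullary.Decidable using (⌊_⌋)
open import Data.Fin.Properties using (_≟_)
open import Data.Vec.Properties using () renaming (≡-dec to vec-≡-dec)
open import Data.Bool.Properties using () renaming (_≟_ to _≟ᵇ_)
open import Level using (0ℓ)
import Data.Bool.ListAction as BL

iter : {A : Set} → (A → A) → ℕ → A → A
iter f zero    x = x
iter f (suc k) x = f (iter f k x)

ℕtoℚ : ℕ → ℚ
ℕtoℚ k = (+ k) / 1

𝟙 : Bool → ℚ
𝟙 b = if b then 1ℚ else 0ℚ

sumℚ : List ℚ → ℚ
sumℚ = List.foldr ℚ._+_ 0ℚ

-- average of a total q over k items:  q / k  (k = 0 never occurs below)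
avg : ℚ → ℕ → ℚ
avg q zero    = 0ℚ
avg q (suc k) = q ℚ.* ((+ 1) / suc k)

allSubsets : (m : ℕ) → List (Subset m)
allSubsets zero    = [] ∷ []
allSubsets (suc m) = List.map (true ∷_) (allSubsets m) ++ List.map (false ∷_) (allSubsets m)

record FinPoset : Set₁ where
  field
    n        : ℕ
    _≤_      : Rel (Fin n) 0ℓ
    _≤?_     : Decidable _≤_
    isPO     : IsPartialOrder _≡_ _≤_

module _ (P : FinPoset) where
  open FinPoset P

  anyP : (Fin n → Bool) → Bool
  anyP f = BL.any f (List.allFin n)

  allP : (Fin n → Bool) → Bool
  allP f = BL.all f (List.allFin n)

  countP : (Fin n → Bool) → ℕ
  countP f = List.length (List.filterᵇ f (List.allFin n))

  leqᵇ : Fin n → Fin n → Bool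
  leqᵇ x y = ⌊ x ≤? y ⌋

  ltᵇ : Fin n → Fin n → Bool
  ltᵇ x y = leqᵇ x y ∧ not ⌊ x ≟ y ⌋

  _<P_ : Fin n → Fin n → Set
  x <P y = x ≤ y × x ≢ y

  CoversP : Fin n → Fin n → Set
  CoversP p q = p <P q × ¬ (∃ λ z → p <P z × z <P q)

  data Zigzag : Fin n → Fin n → Set where
    here : ∀ {x} → Zigzag x x
    step : ∀ {x y z} → (x ≤ y ⊎ y ≤ x) → Zigzag y z → Zigzag x z

  Connected : Set
  Connected = ∀ x y → Zigzag x y

  _∈ᵇ_ : Fin n → Subset n → Bool
  x ∈ᵇ I = lookup I x

  isIdeal : Subset n → Bool
  isIdeal I = allP λ y → allP λ x → not (y ∈ᵇ I ∧ leqᵇ x y) ∨ x ∈ᵇ I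

  ideals : List (Subset n)
  ideals = List.filterᵇ isIdeal (allSubsets n)

  numIdeals : ℕ
  numIdeals = List.length ideals

  ⊆ᵇ : Subset n → Subset n → Bool
  ⊆ᵇ A B = allP λ x → not (x ∈ᵇ A) ∨ x ∈ᵇ B

  ⊊ᵇ : Subset n → Subset n → Bool
  ⊊ᵇ A B = ⊆ᵇ A B ∧ not ⌊ vec-≡-dec _≟ᵇ_ A B ⌋

  coversJ : Subset n → Subset n → Bool
  coversJ K I = isIdeal K ∧ ⊊ᵇ K I ∧
                not (BL.any (λ L → ⊊ᵇ K L ∧ ⊊ᵇ L I) ideals)

  ddeg : Subset n → ℕ
  ddeg I = List.length (List.filterᵇ (λ K → coversJ K I) ideals)

  antichainCard : Subset n → ℕ
  antichainCard I = countP λ x → x ∈ᵇ I ∧ allP (λ z → not (ltᵇ x z) ∨ not (z ∈ᵇ I))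

  minCompl : Subset n → Fin n → Bool
  minCompl I y = not (y ∈ᵇ I) ∧ allP (λ z → not (ltᵇ z y) ∨ z ∈ᵇ I)

  row : Subset n → Subset n
  row I = tabulate λ x → anyP λ y → minCompl I y ∧ leqᵇ x y

  T⁺ : Fin n → Subset n → Bool
  T⁺ p I = minCompl I p

  T⁻ : Fin n → Subset n → Bool
  T⁻ p I = p ∈ᵇ I ∧ allP (λ z → not (ltᵇ p z) ∨ not (z ∈ᵇ I))

  toggle : Fin n → Subset n → Subset n
  toggle p I = if T⁺ p I then I [ p ]≔ true
               else (if T⁻ p I then I [ p ]≔ false else I)

  E : (Subset n → ℚ) → (Subset n → ℚ) → ℚ
  E μ f = sumℚ (List.map (λ I → μ I ℚ.* f I) ideals)

  IsDistribution : (Subset n → ℚ) → Set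
  IsDistribution μ = (∀ S → 0ℚ ℚ.≤ μ S)
                   × (∀ S → isIdeal S ≡ false → μ S ≡ 0ℚ)
                   × (sumℚ (List.map μ ideals) ≡ 1ℚ)

  ToggleSymmetric : (Subset n → ℚ) → Set
  ToggleSymmetric μ = ∀ p → E μ (λ I → 𝟙 (T⁺ p I)) ≡ E μ (λ I → 𝟙 (T⁻ p I))

  uni : Subset n → ℚ
  uni I = avg (𝟙 (isIdeal I)) numIdeals

  tCDE : ℚ → Set
  tCDE c = (∀ μ → IsDistribution μ → ToggleSymmetric μ → E μ (λ I → ℕtoℚ (ddeg I)) ≡ c)
         × (E uni (λ I → ℕtoℚ (ddeg I)) ≡ c)

  -- f is c-mesic w.r.t. Φ (Φ assumed to act on J(P)): for every orbit
  -- {I, Φ I, …, Φ^k I} of exact size suc k, the average of f over it is c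
  Mesic : (Subset n → ℕ) → (Subset n → Subset n) → ℚ → Set
  Mesic f Φ c = ∀ I → isIdeal I ≡ true → ∀ k →
                iter Φ (suc k) I ≡ I →
                (∀ j → suc j ℕ.< suc k → iter Φ (suc j) I ≢ I) →
                avg (sumℚ (List.map (λ j → ℕtoℚ (f (iter Φ j I))) (List.upTo (suc k)))) (suc k) ≡ c

  IsRankFunction : (Fin n → ℕ) → Set
  IsRankFunction rk = (∃ λ p → rk p ≡ 0) × (∀ p q → CoversP p q → rk q ≡ suc (rk p))

  τrank : (Fin n → ℕ) → ℕ → Subset n → Subset n
  τrank rk i I = List.foldr (λ p J → if ⌊ rk p ℕ.≟ i ⌋ then toggle p J else J) I (List.allFin n)

  rowσ : (Fin n → ℕ) → (r : ℕ) → Permutation′ (suc r) → Subset n → Subset n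
  rowσ rk r σ I = List.foldr (λ j J → τrank rk (toℕ (σ ⟨$⟩ʳ j)) J) I (List.allFin (suc r))

-- In J(P) the ideals covered by I are exactly I ∖ {x} for x maximal in I, so ddeg(I) = #max(I).
-- The uniform distribution on a Φ-orbit is toggle-symmetric as soon as, summed along the orbit,
-- every p can be toggled in exactly as often as out; then tCDE says that the orbit average of
-- ddeg, i.e. of #max, is c. For rowmotion this holds because max(Φ_row I) = min(P ∖ I).
-- For Φ_row(σ), each p is toggled exactly once per step, from an intermediate state that agrees
-- with the current ideal or with the next one on all covers of p, since these lie in a single
-- rank other than that of p. As T⁺_p and T⁻_p only see p and its covers, the counts along the
-- orbit equal those at the intermediate states, where p enters exactly as often as it leaves.

module Submission where

open import Defs
open import Data.Nat as ℕ using (ℕ; zero; suc; _+_; _*_)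
open import Data.Nat.Induction using (<-wellFounded)
open import Induction.WellFounded using (Acc; acc)
import Data.Nat.Properties as ℕₚ
open import Data.Bool using (Bool; true; false; _∧_; _∨_; not; if_then_else_)
open import Data.Bool.Properties using (T-≡; ⇔→≡) renaming (_≟_ to _≟ᵇ_)
import Data.Bool.ListAction as BL
open import Data.Fin using (Fin; toℕ; fromℕ<)
open import Data.Fin.Properties using (_≟_; toℕ-injective; toℕ-fromℕ<)
open import Data.Fin.Permutation using (Permutation′; _⟨$⟩ʳ_; _⟨$⟩ˡ_; inverseˡ; inverseʳ)
open import Data.Fin.Subset using (Subset)
open import Data.Vec using (Vec; []; _∷_; lookup; _[_]≔_)
open import Data.Vec.Properties using (∷-injectiveʳ; lookup∘tabulate; lookup∘update; lookup∘update′)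
  renaming (≡-dec to vec-≡-dec)
open import Data.Vec.Relation.Binary.Pointwise.Extensional using (ext; extensional⇒inductive)
open import Data.Vec.Relation.Binary.Pointwise.Inductive using (Pointwise-≡⇒≡)
open import Data.List as List using (List; []; _∷_; _++_)
import Data.List.Properties as Listₚ
open import Data.List.Membership.Propositional using (_∈_; _∉_; lose; find)
open import Data.List.Membership.Propositional.Properties
  using (∈-allFin; ∈-map⁺; ∈-map⁻; ∈-++⁺ˡ; ∈-++⁺ʳ; ∈-∃++; ∈-filter⁺; ∈-filter⁻)
open import Data.List.Relation.Unary.Any using (here; there; any?)
open import Data.List.Relation.Unary.Any.Properties using (any⁺; any⁻)
open import Data.List.Relation.Unary.All as All using ([])
open import Data.List.Relation.Unary.All.Properties using (all⁺)
open import Data.List.Relation.Unary.AllPairs using ([]; _∷_)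
open import Data.List.Relation.Unary.Unique.Propositional using (Unique)
open import Data.List.Relation.Binary.Disjoint.Propositional using (Disjoint)
import Data.List.Relation.Unary.Unique.Propositional.Properties as Uniqueₚ
open import Data.Product using (∃; ∃-syntax; _×_; _,_; proj₁; proj₂)
open import Data.Sum as Sum using (_⊎_; inj₁; inj₂)
open import Data.Empty using (⊥; ⊥-elim)
import Data.Integer as ℤ
import Data.Integer.Properties as ℤₚ
import Data.Nat.Coprimality as Cop
open import Data.Rational as ℚ using (ℚ; 0ℚ; 1ℚ)
import Data.Rational.Properties as ℚₚ
open import Function using (id; _∘_; mk⇔; Equivalence)
open import Relation.Binary using (IsPartialOrder)
open import Relation.Binary.PropositionalEquality
open import Relation.Nullary using (Dec; yes; no)
open import Relation.Nullary.Decidable using (⌊_⌋; T?)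
open import Algebra.Properties.CommutativeSemigroup ℕₚ.+-commutativeSemigroup using (interchange)

private
  variable
    A B : Set

χ : Bool → ℕ
χ b = if b then 1 else 0

∧-elimˡ : ∀ {a b} → a ∧ b ≡ true → a ≡ true
∧-elimˡ {true} _ = refl

∧-elimʳ : ∀ {a b} → a ∧ b ≡ true → b ≡ true
∧-elimʳ {true} e = e

∧-intro : ∀ {a b} → a ≡ true → b ≡ true → a ∧ b ≡ true
∧-intro refl refl = refl

not-elim : ∀ {a} → not a ≡ true → a ≡ false
not-elim {false} _ = refl

not-intro : ∀ {a} → a ≡ false → not a ≡ true
not-intro refl = refl

⇒ᵇ-elim : ∀ {a b} → not a ∨ b ≡ true → a ≡ true → b ≡ true
⇒ᵇ-elim {true} e refl = e

⇒ᵇ-intro : ∀ {a b} → (a ≡ true → b ≡ true) → not a ∨ b ≡ true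
⇒ᵇ-intro {true} h = h refl
⇒ᵇ-intro {false} h = refl

true≢false : ∀ {a} → a ≡ true → a ≢ false
true≢false refl ()

≢true⇒false : ∀ {a} → a ≢ true → a ≡ false
≢true⇒false {true} h = ⊥-elim (h refl)
≢true⇒false {false} h = refl

≢false⇒true : ∀ {a} → a ≢ false → a ≡ true
≢false⇒true {true} h = refl
≢false⇒true {false} h = ⊥-elim (h refl)

≡true-ext : ∀ {a b} → (a ≡ true → b ≡ true) → (b ≡ true → a ≡ true) → a ≡ b
≡true-ext f g = ⇔→≡ (mk⇔ f g)

⌊⌋-sound : ∀ {p} {A : Set p} (d : Dec A) → ⌊ d ⌋ ≡ true → A
⌊⌋-sound (yes a) _ = a

⌊⌋-complete : ∀ {p} {A : Set p} (d : Dec A) → A → ⌊ d ⌋ ≡ true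
⌊⌋-complete (yes _) _ = refl
⌊⌋-complete (no ¬a) a = ⊥-elim (¬a a)

module _ (f : A → Bool) where

  all-sound : ∀ {xs x} → BL.all f xs ≡ true → x ∈ xs → f x ≡ true
  all-sound e x∈ = Equivalence.to T-≡ (All.lookup (all⁺ f _ (Equivalence.from T-≡ e)) x∈)

  all-complete : ∀ xs → (∀ {x} → x ∈ xs → f x ≡ true) → BL.all f xs ≡ true
  all-complete [] h = refl
  all-complete (y ∷ ys) h = ∧-intro (h (here refl)) (all-complete ys (h ∘ there))

  any-sound : ∀ xs → BL.any f xs ≡ true → ∃[ x ] x ∈ xs × f x ≡ true
  any-sound xs e with find (any⁻ f xs (Equivalence.from T-≡ e))
  ... | x , x∈ , fx = x , x∈ , Equivalence.to T-≡ fx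

  any-complete : ∀ {xs x} → x ∈ xs → f x ≡ true → BL.any f xs ≡ true
  any-complete x∈ fx = Equivalence.to T-≡ (any⁺ f (lose x∈ (Equivalence.from T-≡ fx)))

  ∈-filterᵇ⁺ : ∀ {xs x} → x ∈ xs → f x ≡ true → x ∈ List.filterᵇ f xs
  ∈-filterᵇ⁺ x∈ fx = ∈-filter⁺ (T? ∘ f) x∈ (Equivalence.from T-≡ fx)

  ∈-filterᵇ⁻ : ∀ {xs x} → x ∈ List.filterᵇ f xs → f x ≡ true
  ∈-filterᵇ⁻ {xs} x∈ = Equivalence.to T-≡ (proj₂ (∈-filter⁻ (T? ∘ f) {xs = xs} x∈))

∑ : List A → (A → ℕ) → ℕ
∑ [] f = 0
∑ (x ∷ xs) f = f x + ∑ xs f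

syntax ∑ xs (λ x → e) = ∑[ x ← xs ] e

∑< : ℕ → (ℕ → ℕ) → ℕ
∑< zero g = 0
∑< (suc K) g = g 0 + ∑< K (g ∘ suc)

syntax ∑< K (λ t → e) = ∑[ t < K ] e

∑-cong : ∀ (xs : List A) {f g : A → ℕ} → (∀ {x} → x ∈ xs → f x ≡ g x) → ∑ xs f ≡ ∑ xs g
∑-cong [] h = refl
∑-cong (x ∷ xs) h = cong₂ _+_ (h (here refl)) (∑-cong xs (h ∘ there))

∑-zero : ∀ (xs : List A) {f : A → ℕ} → (∀ {x} → x ∈ xs → f x ≡ 0) → ∑ xs f ≡ 0
∑-zero [] h = refl
∑-zero (x ∷ xs) h = cong₂ _+_ (h (here refl)) (∑-zero xs (h ∘ there))

∑-distrib-+ : ∀ (xs : List A) (f g : A → ℕ) → ∑[ x ← xs ] (f x + g x) ≡ ∑ xs f + ∑ xs g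
∑-distrib-+ [] f g = refl
∑-distrib-+ (x ∷ xs) f g rewrite ∑-distrib-+ xs f g = interchange (f x) (g x) (∑ xs f) (∑ xs g)

∑-swap : (xs : List A) (ys : List B) (f : A → B → ℕ) →
         ∑[ x ← xs ] ∑ ys (f x) ≡ ∑[ y ← ys ] ∑[ x ← xs ] f x y
∑-swap [] ys f = sym (∑-zero ys (λ _ → refl))
∑-swap (x ∷ xs) ys f rewrite ∑-swap xs ys f = sym (∑-distrib-+ ys (f x) _)

length-filterᵇ : (p : A → Bool) (xs : List A) → List.length (List.filterᵇ p xs) ≡ ∑[ x ← xs ] χ (p x)
length-filterᵇ p [] = refl
length-filterᵇ p (x ∷ xs) with p x
... | true = cong suc (length-filterᵇ p xs)
... | false = length-filterᵇ p xs

∑-point : ∀ {xs : List A} (f : A → ℕ) {a} → Unique xs → a ∈ xs →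
          (∀ {x} → x ∈ xs → x ≢ a → f x ≡ 0) → ∑ xs f ≡ f a
∑-point {xs = x ∷ xs} f (x∉ ∷ u) (here refl) h =
  trans (cong (f x +_) (∑-zero xs (λ y∈ → h (there y∈) (λ { refl → All.lookup x∉ y∈ refl }))))
        (ℕₚ.+-identityʳ (f x))
∑-point {xs = x ∷ xs} f (x∉ ∷ u) (there a∈) h =
  cong₂ _+_ (h (here refl) (λ { refl → All.lookup x∉ a∈ refl })) (∑-point f u a∈ (h ∘ there))

∑-mono-≤ : ∀ (xs : List A) {f g : A → ℕ} → (∀ {x} → x ∈ xs → f x ℕ.≤ g x) → ∑ xs f ℕ.≤ ∑ xs g
∑-mono-≤ [] h = ℕ.z≤n
∑-mono-≤ (x ∷ xs) h = ℕₚ.+-mono-≤ (h (here refl)) (∑-mono-≤ xs (h ∘ there))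

∑-mono-< : ∀ {xs : List A} {f g : A → ℕ} {a} → a ∈ xs →
           (∀ {x} → x ∈ xs → f x ℕ.≤ g x) → f a ℕ.< g a → ∑ xs f ℕ.< ∑ xs g
∑-mono-< {xs = x ∷ xs} (here refl) h lt = ℕₚ.+-mono-<-≤ lt (∑-mono-≤ xs (h ∘ there))
∑-mono-< {xs = x ∷ xs} (there a∈) h lt = ℕₚ.+-mono-≤-< (h (here refl)) (∑-mono-< a∈ (h ∘ there) lt)

∑<-cong : ∀ K {f g : ℕ → ℕ} → (∀ t → f t ≡ g t) → ∑< K f ≡ ∑< K g
∑<-cong zero h = refl
∑<-cong (suc K) h = cong₂ _+_ (h 0) (∑<-cong K (h ∘ suc))

∑<-distrib-+ : ∀ K (f g : ℕ → ℕ) → ∑[ t < K ] (f t + g t) ≡ ∑< K f + ∑< K g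
∑<-distrib-+ zero f g = refl
∑<-distrib-+ (suc K) f g rewrite ∑<-distrib-+ K (f ∘ suc) (g ∘ suc) = interchange (f 0) (g 0) _ _

∑<-distribʳ-* : ∀ K (f : ℕ → ℕ) c → ∑< K f * c ≡ ∑[ t < K ] (f t * c)
∑<-distribʳ-* zero f c = refl
∑<-distribʳ-* (suc K) f c = trans (ℕₚ.*-distribʳ-+ c (f 0) _) (cong (f 0 * c +_) (∑<-distribʳ-* K (f ∘ suc) c))

∑<-const-1 : ∀ K → ∑[ t < K ] 1 ≡ K
∑<-const-1 zero = refl
∑<-const-1 (suc K) = cong suc (∑<-const-1 K)

∑<-zero : ∀ K (f : ℕ → ℕ) → (∀ t → f t ≡ 0) → ∑< K f ≡ 0
∑<-zero zero f h = refl
∑<-zero (suc K) f h = cong₂ _+_ (h 0) (∑<-zero K (f ∘ suc) (h ∘ suc))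

∑<-last : ∀ K (g : ℕ → ℕ) → ∑< (suc K) g ≡ ∑< K g + g K
∑<-last zero g = ℕₚ.+-comm (g 0) 0
∑<-last (suc K) g = trans (cong (g 0 +_) (∑<-last K (g ∘ suc))) (sym (ℕₚ.+-assoc (g 0) _ _))

∑<-rotate : ∀ k (g : ℕ → ℕ) → g (suc k) ≡ g 0 → ∑[ t < suc k ] g (suc t) ≡ ∑< (suc k) g
∑<-rotate k g periodic = begin
  ∑[ t < suc k ] g (suc t)         ≡⟨ ∑<-last k (g ∘ suc) ⟩
  ∑[ t < k ] g (suc t) + g (suc k) ≡⟨ cong (∑< k (g ∘ suc) +_) periodic ⟩
  ∑[ t < k ] g (suc t) + g 0       ≡⟨ ℕₚ.+-comm _ (g 0) ⟩
  ∑< (suc k) g                     ∎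
  where open ≡-Reasoning

∑<-swap-∑ : ∀ K (xs : List A) (f : ℕ → A → ℕ) →
            ∑[ t < K ] ∑ xs (f t) ≡ ∑[ x ← xs ] ∑[ t < K ] f t x
∑<-swap-∑ zero xs f = sym (∑-zero xs (λ _ → refl))
∑<-swap-∑ (suc K) xs f rewrite ∑<-swap-∑ K xs (f ∘ suc) = sym (∑-distrib-+ xs (f 0) _)

∑-upTo : ∀ K (g : ℕ → ℕ) → ∑ (List.upTo K) g ≡ ∑< K g
∑-upTo K g = ∑-applyUpTo id K g
  where
  ∑-applyUpTo : ∀ (h : ℕ → ℕ) K (g : ℕ → ℕ) → ∑ (List.applyUpTo h K) g ≡ ∑[ t < K ] g (h t)
  ∑-applyUpTo h zero g = refl
  ∑-applyUpTo h (suc K) g = cong (g (h 0) +_) (∑-applyUpTo (h ∘ suc) K g)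

∈-unique-split : ∀ {xs : List A} {a} → Unique xs → a ∈ xs →
                 ∃[ pre ] ∃[ post ] xs ≡ pre ++ a ∷ post × a ∉ pre × a ∉ post × Disjoint pre post
∈-unique-split unique a∈ with ∈-∃++ a∈
... | pre , post , refl = pre , post , refl , split pre unique
  where
  split : ∀ pre {a : A} {post} → Unique (pre ++ a ∷ post) → a ∉ pre × a ∉ post × Disjoint pre post
  split [] (a∉post ∷ _) = (λ ()) , (λ a∈ → All.lookup a∉post a∈ refl) , λ ()
  split (x ∷ pre) (x∉rest ∷ unique) with split pre unique
  ... | a∉pre , a∉post , disjoint = a∉x∷pre , a∉post , x∷pre-disjoint
    where
    a∉x∷pre : _ ∉ x ∷ pre
    a∉x∷pre (here refl) = All.lookup x∉rest (∈-++⁺ʳ pre (here refl)) refl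
    a∉x∷pre (there a∈) = a∉pre a∈
    x∷pre-disjoint : Disjoint (x ∷ pre) _
    x∷pre-disjoint (here refl , x∈post) = All.lookup x∉rest (∈-++⁺ʳ pre (there x∈post)) refl
    x∷pre-disjoint (there b∈ , b∈post) = disjoint (b∈ , b∈post)

foldr-preserves : ∀ (Q : B → Set) {G : A → B → B} → (∀ a {b} → Q b → Q (G a b)) →
                  ∀ {b} → Q b → ∀ xs → Q (List.foldr G b xs)
foldr-preserves Q pres qb [] = qb
foldr-preserves Q pres qb (a ∷ xs) = pres a (foldr-preserves Q pres qb xs)

lookup-foldr-frame : ∀ {m} (G : A → Vec B m → Vec B m) {y} xs →
                     (∀ {a} → a ∈ xs → ∀ Z → lookup (G a Z) y ≡ lookup Z y) →
                     ∀ X → lookup (List.foldr G X xs) y ≡ lookup X y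
lookup-foldr-frame G [] frame X = refl
lookup-foldr-frame G (a ∷ xs) frame X = trans (frame (here refl) _) (lookup-foldr-frame G xs (frame ∘ there) X)

lookup-ext : ∀ {m} {u v : Vec A m} → (∀ i → lookup u i ≡ lookup v i) → u ≡ v
lookup-ext h = Pointwise-≡⇒≡ (extensional⇒inductive (ext h))

_≡ᵇ_ : ∀ {m} → Subset m → Subset m → Bool
U ≡ᵇ V = ⌊ vec-≡-dec _≟ᵇ_ U V ⌋

≡ᵇ-sound : ∀ {m} {U V : Subset m} → U ≡ᵇ V ≡ true → U ≡ V
≡ᵇ-sound = ⌊⌋-sound (vec-≡-dec _≟ᵇ_ _ _)

≡ᵇ-complete : ∀ {m} {U V : Subset m} → U ≡ V → U ≡ᵇ V ≡ true
≡ᵇ-complete = ⌊⌋-complete (vec-≡-dec _≟ᵇ_ _ _)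

∈-allSubsets : ∀ m (U : Subset m) → U ∈ allSubsets m
∈-allSubsets zero [] = here refl
∈-allSubsets (suc m) (true ∷ U) = ∈-++⁺ˡ (∈-map⁺ (true ∷_) (∈-allSubsets m U))
∈-allSubsets (suc m) (false ∷ U) =
  ∈-++⁺ʳ (List.map (true ∷_) (allSubsets m)) (∈-map⁺ (false ∷_) (∈-allSubsets m U))

allSubsets-unique : ∀ m → Unique (allSubsets m)
allSubsets-unique zero = [] ∷ []
allSubsets-unique (suc m) =
  Uniqueₚ.++⁺ (Uniqueₚ.map⁺ ∷-injectiveʳ (allSubsets-unique m))
              (Uniqueₚ.map⁺ ∷-injectiveʳ (allSubsets-unique m))
              headsDiffer
  where
  headsDiffer : ∀ {U} → U ∈ List.map (true ∷_) (allSubsets m) × U ∈ List.map (false ∷_) (allSubsets m) → ⊥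
  headsDiffer (U∈ , U∈′) with ∈-map⁻ (true ∷_) U∈ | ∈-map⁻ (false ∷_) U∈′
  ... | _ , _ , refl | _ , _ , ()

ℕtoℚ-mkℚ : ∀ a → ℕtoℚ a ≡ ℚ.mkℚ (ℤ.+ a) 0 (Cop.sym (Cop.1-coprimeTo a))
ℕtoℚ-mkℚ a = ℚₚ.normalize-coprime (Cop.sym (Cop.1-coprimeTo a))

ℕtoℚ-+ : ∀ a b → ℕtoℚ (a + b) ≡ ℕtoℚ a ℚ.+ ℕtoℚ b
ℕtoℚ-+ a b rewrite ℕtoℚ-mkℚ a | ℕtoℚ-mkℚ b =
  cong (ℚ._/ 1) (sym (cong₂ ℤ._+_ (ℤₚ.*-identityʳ (ℤ.+ a)) (ℤₚ.*-identityʳ (ℤ.+ b))))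

ℕtoℚ-* : ∀ a b → ℕtoℚ (a * b) ≡ ℕtoℚ a ℚ.* ℕtoℚ b
ℕtoℚ-* a b rewrite ℕtoℚ-mkℚ a | ℕtoℚ-mkℚ b = cong (ℚ._/ 1) (ℤₚ.pos-* a b)

sumℚ-ℕtoℚ : ∀ (xs : List A) (h : A → ℕ) → sumℚ (List.map (ℕtoℚ ∘ h) xs) ≡ ℕtoℚ (∑ xs h)
sumℚ-ℕtoℚ [] h = refl
sumℚ-ℕtoℚ (x ∷ xs) h rewrite sumℚ-ℕtoℚ xs h = sym (ℕtoℚ-+ (h x) _)

sumℚ-scaled-ℕtoℚ : ∀ (xs : List A) (c : ℚ) (h : A → ℕ) →
                   sumℚ (List.map (λ x → c ℚ.* ℕtoℚ (h x)) xs) ≡ c ℚ.* ℕtoℚ (∑ xs h)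
sumℚ-scaled-ℕtoℚ [] c h = sym (ℚₚ.*-zeroʳ c)
sumℚ-scaled-ℕtoℚ (x ∷ xs) c h rewrite sumℚ-scaled-ℕtoℚ xs c h =
  trans (sym (ℚₚ.*-distribˡ-+ c (ℕtoℚ (h x)) _)) (cong (c ℚ.*_) (sym (ℕtoℚ-+ (h x) _)))

𝟙≡ℕtoℚ∘χ : ∀ b → 𝟙 b ≡ ℕtoℚ (χ b)
𝟙≡ℕtoℚ∘χ true = refl
𝟙≡ℕtoℚ∘χ false = refl

-- avg q (suc k) unfolds to q ℚ.* 1/[1+ k ].
1/[1+_] : ℕ → ℚ
1/[1+ k ] = (ℤ.+ 1) ℚ./ suc k

1/[1+]-*-ℕtoℚ : ∀ k → 1/[1+ k ] ℚ.* ℕtoℚ (suc k) ≡ 1ℚ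
1/[1+]-*-ℕtoℚ k rewrite ℚₚ.normalize-coprime (Cop.1-coprimeTo (suc k)) | ℕtoℚ-mkℚ (suc k) =
  ℚₚ.*-inverseˡ (ℚ.mkℚ (ℤ.+ suc k) 0 (Cop.sym (Cop.1-coprimeTo (suc k))))

1/[1+]-*-ℕtoℚ-nonNeg : ∀ k a → 0ℚ ℚ.≤ 1/[1+ k ] ℚ.* ℕtoℚ a
1/[1+]-*-ℕtoℚ-nonNeg k a = ℚₚ.nonNegative⁻¹ _
  {{ℚₚ.nonNeg*nonNeg⇒nonNeg 1/[1+ k ] {{ℚₚ.normalize-nonNeg 1 (suc k)}} (ℕtoℚ a) {{ℚₚ.normalize-nonNeg a 1}}}}

-- Order ideals of a finite poset

module Poset (P : FinPoset) where

  open FinPoset P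
  open IsPartialOrder isPO using (antisym) renaming (reflexive to ≤-reflexive; trans to ≤-trans)

  infix 4 _<_
  _<_ : Fin n → Fin n → Set
  x < y = _<P_ P x y

  ≤-refl : ∀ {x} → x ≤ x
  ≤-refl = ≤-reflexive refl

  <⇒≤ : ∀ {x y} → x < y → x ≤ y
  <⇒≤ = proj₁

  <-≤-trans : ∀ {x y z} → x < y → y ≤ z → x < z
  <-≤-trans (x≤y , x≢y) y≤z = ≤-trans x≤y y≤z , λ { refl → x≢y (antisym x≤y y≤z) }

  leqᵇ-sound : ∀ {x y} → leqᵇ P x y ≡ true → x ≤ y
  leqᵇ-sound = ⌊⌋-sound (_ ≤? _)

  leqᵇ-complete : ∀ {x y} → x ≤ y → leqᵇ P x y ≡ true
  leqᵇ-complete = ⌊⌋-complete (_ ≤? _)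

  ltᵇ-sound : ∀ {x y} → ltᵇ P x y ≡ true → x < y
  ltᵇ-sound {x} {y} e =
    leqᵇ-sound (∧-elimˡ e) , λ x≡y → true≢false (⌊⌋-complete (x ≟ y) x≡y) (not-elim (∧-elimʳ e))

  ltᵇ-complete : ∀ {x y} → x < y → ltᵇ P x y ≡ true
  ltᵇ-complete {x} {y} (x≤y , x≢y) =
    ∧-intro (leqᵇ-complete x≤y) (not-intro (≢true⇒false (x≢y ∘ ⌊⌋-sound (x ≟ y))))

  allP-sound : ∀ {f} → allP P f ≡ true → ∀ x → f x ≡ true
  allP-sound {f} e x = all-sound f e (∈-allFin x)

  allP-complete : ∀ {f} → (∀ x → f x ≡ true) → allP P f ≡ true
  allP-complete {f} h = all-complete f (List.allFin n) (λ {x} _ → h x)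

  anyP-sound : ∀ {f} → anyP P f ≡ true → ∃[ x ] f x ≡ true
  anyP-sound {f} e with any-sound f (List.allFin n) e
  ... | x , _ , fx = x , fx

  anyP-complete : ∀ {f} x → f x ≡ true → anyP P f ≡ true
  anyP-complete {f} x = any-complete f (∈-allFin x)

  extremal : (r : Fin n → Fin n → Bool) (m : Fin n → ℕ) → (∀ {z y} → r z y ≡ true → m z ℕ.< m y) →
             (d : Fin n → Bool) → ∀ x → d x ≡ true →
             ∃[ y ] d y ≡ true × (∀ z → r z y ≡ true → d z ≡ false)
  extremal r m r-decreasing d x dx = go x dx (<-wellFounded (m x))
    where
    go : ∀ x → d x ≡ true → Acc ℕ._<_ (m x) → ∃[ y ] d y ≡ true × (∀ z → r z y ≡ true → d z ≡ false)
    go x dx (acc rs) with anyP P (λ z → r z x ∧ d z) in smaller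
    ... | true = let z , rz = anyP-sound smaller in go z (∧-elimʳ rz) (rs (r-decreasing (∧-elimˡ rz)))
    ... | false = x , dx , λ z rzx → ≢true⇒false λ dz → true≢false (anyP-complete z (∧-intro rzx dz)) smaller

  #below #above : Fin n → ℕ
  #below x = ∑[ w ← List.allFin n ] χ (leqᵇ P w x)
  #above x = ∑[ w ← List.allFin n ] χ (leqᵇ P x w)

  χ-mono : ∀ {a b} → (a ≡ true → b ≡ true) → χ a ℕ.≤ χ b
  χ-mono {false} h = ℕ.z≤n
  χ-mono {true} h rewrite h refl = ℕ.s≤s ℕ.z≤n

  χ-leqᵇ-< : ∀ {a b c} → a < b → χ (leqᵇ P b a) ℕ.< χ (leqᵇ P c c)
  χ-leqᵇ-< {a} {b} {c} (a≤b , a≢b) rewrite leqᵇ-complete (≤-refl {c}) with leqᵇ P b a in b≤a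
  ... | true = ⊥-elim (a≢b (antisym a≤b (leqᵇ-sound b≤a)))
  ... | false = ℕ.s≤s ℕ.z≤n

  #below-mono : ∀ {z x} → ltᵇ P z x ≡ true → #below z ℕ.< #below x
  #below-mono {z} {x} z<x with ltᵇ-sound z<x
  ... | z<x′@(z≤x , _) = ∑-mono-< {f = λ w → χ (leqᵇ P w z)} {g = λ w → χ (leqᵇ P w x)} (∈-allFin x)
    (λ _ → χ-mono λ w≤z → leqᵇ-complete (≤-trans (leqᵇ-sound w≤z) z≤x)) (χ-leqᵇ-< z<x′)

  #above-mono : ∀ {z x} → ltᵇ P x z ≡ true → #above z ℕ.< #above x
  #above-mono {z} {x} x<z with ltᵇ-sound x<z
  ... | x<z′@(x≤z , _) = ∑-mono-< {f = λ w → χ (leqᵇ P z w)} {g = λ w → χ (leqᵇ P x w)} (∈-allFin x)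
    (λ _ → χ-mono λ z≤w → leqᵇ-complete (≤-trans x≤z (leqᵇ-sound z≤w))) (χ-leqᵇ-< x<z′)

  minimal : (d : Fin n → Bool) → ∀ x → d x ≡ true → ∃[ y ] d y ≡ true × (∀ z → z < y → d z ≡ false)
  minimal d x dx with extremal (ltᵇ P) #below #below-mono d x dx
  ... | y , dy , min = y , dy , λ z z<y → min z (ltᵇ-complete z<y)

  maximal : (d : Fin n → Bool) → ∀ x → d x ≡ true → ∃[ y ] d y ≡ true × (∀ z → y < z → d z ≡ false)
  maximal d x dx with extremal (λ z y → ltᵇ P y z) #above #above-mono d x dx
  ... | y , dy , max = y , dy , λ z y<z → max z (ltᵇ-complete y<z)

  lowerCover : ∀ {z p} → z < p → ∃[ c ] z ≤ c × CoversP P c p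
  lowerCover {z} {p} z<p
    with maximal (λ w → leqᵇ P z w ∧ ltᵇ P w p) z (∧-intro (leqᵇ-complete ≤-refl) (ltᵇ-complete z<p))
  ... | c , z≤c<p , max = c , z≤c , c<p , λ { (w , c<w , w<p) →
          true≢false (∧-intro (leqᵇ-complete (≤-trans z≤c (<⇒≤ c<w))) (ltᵇ-complete w<p)) (max w c<w) }
    where
    z≤c : z ≤ c
    z≤c = leqᵇ-sound (∧-elimˡ z≤c<p)
    c<p : c < p
    c<p = ltᵇ-sound (∧-elimʳ {leqᵇ P z c} z≤c<p)

  upperCover : ∀ {z p} → p < z → ∃[ c ] CoversP P p c × c ≤ z
  upperCover {z} {p} p<z
    with minimal (λ w → ltᵇ P p w ∧ leqᵇ P w z) z (∧-intro (ltᵇ-complete p<z) (leqᵇ-complete ≤-refl))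
  ... | c , p<c≤z , min = c , (p<c , λ { (w , p<w , w<c) →
          true≢false (∧-intro (ltᵇ-complete p<w) (leqᵇ-complete (≤-trans (<⇒≤ w<c) c≤z))) (min w w<c) }) , c≤z
    where
    p<c : p < c
    p<c = ltᵇ-sound (∧-elimˡ p<c≤z)
    c≤z : c ≤ z
    c≤z = leqᵇ-sound (∧-elimʳ {ltᵇ P p c} p<c≤z)

  infix 4 _∈ₛ_
  _∈ₛ_ : Fin n → Subset n → Set
  x ∈ₛ I = lookup I x ≡ true

  record Ideal (I : Subset n) : Set where
    constructor downClosed
    field closed : ∀ {x y} → y ∈ₛ I → x ≤ y → x ∈ₛ I
  open Ideal public

  isIdeal-sound : ∀ {I} → isIdeal P I ≡ true → Ideal I
  isIdeal-sound e = downClosed λ {x} {y} y∈I x≤y →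
    ⇒ᵇ-elim (allP-sound (allP-sound e y) x) (∧-intro y∈I (leqᵇ-complete x≤y))

  isIdeal-complete : ∀ {I} → Ideal I → isIdeal P I ≡ true
  isIdeal-complete {I} ideal = allP-complete λ y → allP-complete λ x → ⇒ᵇ-intro λ y∈I∧x≤y →
    closed ideal (∧-elimˡ y∈I∧x≤y) (leqᵇ-sound (∧-elimʳ {lookup I y} y∈I∧x≤y))

  ∈ideals⁻ : ∀ {I} → I ∈ ideals P → Ideal I
  ∈ideals⁻ {I} I∈ = isIdeal-sound {I} (∈-filterᵇ⁻ (isIdeal P) {allSubsets n} I∈)

  ∈ideals⁺ : ∀ {I} → Ideal I → I ∈ ideals P
  ∈ideals⁺ {I} ideal = ∈-filterᵇ⁺ (isIdeal P) (∈-allSubsets n I) (isIdeal-complete {I} ideal)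

  ideals-unique : Unique (ideals P)
  ideals-unique = Uniqueₚ.filter⁺ (T? ∘ isIdeal P) (allSubsets-unique n)

  T⁺-sound : ∀ p I → T⁺ P p I ≡ true → lookup I p ≡ false × (∀ {z} → z < p → z ∈ₛ I)
  T⁺-sound p I e = not-elim (∧-elimˡ e) , λ z<p → ⇒ᵇ-elim (allP-sound (∧-elimʳ e) _) (ltᵇ-complete z<p)

  T⁺-complete : ∀ p I → lookup I p ≡ false → (∀ {z} → z < p → z ∈ₛ I) → T⁺ P p I ≡ true
  T⁺-complete p I p∉I below = ∧-intro (not-intro p∉I) (allP-complete λ z → ⇒ᵇ-intro (below ∘ ltᵇ-sound))

  T⁻-sound : ∀ p I → T⁻ P p I ≡ true → p ∈ₛ I × (∀ {z} → p < z → lookup I z ≡ false)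
  T⁻-sound p I e =
    ∧-elimˡ e , λ p<z → not-elim (⇒ᵇ-elim (allP-sound (∧-elimʳ {lookup I p} e) _) (ltᵇ-complete p<z))

  T⁻-complete : ∀ p I → p ∈ₛ I → (∀ {z} → p < z → lookup I z ≡ false) → T⁻ P p I ≡ true
  T⁻-complete p I p∈I above = ∧-intro p∈I (allP-complete λ z → ⇒ᵇ-intro (not-intro ∘ above ∘ ltᵇ-sound))

  add-minimal-ideal : ∀ p {I} → Ideal I → T⁺ P p I ≡ true → Ideal (I [ p ]≔ true)
  add-minimal-ideal p {I} ideal t⁺ = downClosed I[p]≔true-closed
    where
    I[p]≔true-closed : ∀ {x y} → y ∈ₛ I [ p ]≔ true → x ≤ y → x ∈ₛ I [ p ]≔ true
    I[p]≔true-closed {x} {y} y∈ x≤y with x ≟ p | y ≟ p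
    ... | yes refl | _ = lookup∘update p I true
    ... | no x≢p | yes refl = trans (lookup∘update′ x≢p I true) (proj₂ (T⁺-sound p I t⁺) (x≤y , x≢p))
    ... | no x≢p | no y≢p = trans (lookup∘update′ x≢p I true)
                                  (closed ideal (trans (sym (lookup∘update′ y≢p I true)) y∈) x≤y)

  remove-maximal-ideal : ∀ p {I} → Ideal I → T⁻ P p I ≡ true → Ideal (I [ p ]≔ false)
  remove-maximal-ideal p {I} ideal t⁻ = downClosed I[p]≔false-closed
    where
    I[p]≔false-closed : ∀ {x y} → y ∈ₛ I [ p ]≔ false → x ≤ y → x ∈ₛ I [ p ]≔ false
    I[p]≔false-closed {x} {y} y∈ x≤y with y ≟ p
    ... | yes refl = ⊥-elim (true≢false y∈ (lookup∘update p I false))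
    ... | no y≢p with x ≟ p | trans (sym (lookup∘update′ y≢p I false)) y∈
    ...   | yes refl | y∈I = ⊥-elim (true≢false y∈I (proj₂ (T⁻-sound p I t⁻) (x≤y , ≢-sym y≢p)))
    ...   | no x≢p | y∈I = trans (lookup∘update′ x≢p I false) (closed ideal y∈I x≤y)

  toggle-ideal : ∀ p {I} → Ideal I → Ideal (toggle P p I)
  toggle-ideal p {I} ideal with T⁺ P p I in t⁺ | T⁻ P p I in t⁻
  ... | true | _ = add-minimal-ideal p {I} ideal t⁺
  ... | false | true = remove-maximal-ideal p {I} ideal t⁻
  ... | false | false = ideal

  toggle-lookup-other : ∀ p I {y} → y ≢ p → lookup (toggle P p I) y ≡ lookup I y
  toggle-lookup-other p I y≢p with T⁺ P p I | T⁻ P p I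
  ... | true | _ = lookup∘update′ y≢p I true
  ... | false | true = lookup∘update′ y≢p I false
  ... | false | false = refl

  toggle-lookup-self : ∀ p I →
    lookup (toggle P p I) p ≡ (if T⁺ P p I then true else if T⁻ P p I then false else lookup I p)
  toggle-lookup-self p I with T⁺ P p I | T⁻ P p I
  ... | true | _ = lookup∘update p I true
  ... | false | true = lookup∘update p I false
  ... | false | false = refl

  toggle-count : ∀ p I → χ (lookup (toggle P p I) p) + χ (T⁻ P p I) ≡ χ (lookup I p) + χ (T⁺ P p I)
  toggle-count p I with T⁺ P p I in t⁺ | T⁻ P p I in t⁻
  ... | true | true = ⊥-elim (true≢false (proj₁ (T⁻-sound p I t⁻)) (proj₁ (T⁺-sound p I t⁺)))
  ... | true | false = trans (cong (λ b → χ b + 0) (lookup∘update p I true))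
                              (cong (λ b → χ b + 1) (sym (proj₁ (T⁺-sound p I t⁺))))
  ... | false | true = trans (cong (λ b → χ b + 1) (lookup∘update p I false))
                              (cong (λ b → χ b + 0) (sym (proj₁ (T⁻-sound p I t⁻))))
  ... | false | false = refl

  -- Down-degree in J(P)

  infix 4 _⊆_ _⊂_ _⋖_
  _⊆_ _⊂_ _⋖_ : Subset n → Subset n → Set
  A ⊆ B = ∀ {x} → x ∈ₛ A → x ∈ₛ B
  A ⊂ B = A ⊆ B × A ≢ B
  K ⋖ I = Ideal K × K ⊂ I × (∀ L → Ideal L → K ⊂ L → L ⊂ I → ⊥)

  ⊆-antisym : ∀ {A B} → A ⊆ B → B ⊆ A → A ≡ B
  ⊆-antisym A⊆B B⊆A = lookup-ext λ x → ≡true-ext A⊆B B⊆A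

  ⊆ᵇ-sound : ∀ A B → ⊆ᵇ P A B ≡ true → A ⊆ B
  ⊆ᵇ-sound A B e = ⇒ᵇ-elim (allP-sound e _)

  ⊆ᵇ-complete : ∀ A B → A ⊆ B → ⊆ᵇ P A B ≡ true
  ⊆ᵇ-complete A B A⊆B = allP-complete λ x → ⇒ᵇ-intro A⊆B

  ⊊ᵇ-sound : ∀ A B → ⊊ᵇ P A B ≡ true → A ⊂ B
  ⊊ᵇ-sound A B e =
    ⊆ᵇ-sound A B (∧-elimˡ e) , λ A≡B → true≢false (≡ᵇ-complete A≡B) (not-elim (∧-elimʳ {⊆ᵇ P A B} e))

  ⊊ᵇ-complete : ∀ A B → A ⊂ B → ⊊ᵇ P A B ≡ true
  ⊊ᵇ-complete A B (A⊆B , A≢B) =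
    ∧-intro (⊆ᵇ-complete A B A⊆B) (not-intro (≢true⇒false (A≢B ∘ ≡ᵇ-sound)))

  coversJ-sound : ∀ K I → coversJ P K I ≡ true → K ⋖ I
  coversJ-sound K I e with ∧-elimʳ {isIdeal P K} e
  ... | K⊂I∧nothing-between =
    isIdeal-sound {K} (∧-elimˡ e) , ⊊ᵇ-sound K I (∧-elimˡ K⊂I∧nothing-between) , λ L ideal K⊂L L⊂I →
      true≢false (any-complete _ (∈ideals⁺ {L} ideal) (∧-intro (⊊ᵇ-complete K L K⊂L) (⊊ᵇ-complete L I L⊂I)))
                 (not-elim (∧-elimʳ {⊊ᵇ P K I} K⊂I∧nothing-between))

  coversJ-complete : ∀ K I → K ⋖ I → coversJ P K I ≡ true
  coversJ-complete K I (ideal , K⊂I , nothing-between) =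
    ∧-intro (isIdeal-complete {K} ideal) (∧-intro (⊊ᵇ-complete K I K⊂I) (not-intro (≢true⇒false λ e →
      let L , L∈ , K⊂L⊂I = any-sound _ (ideals P) e in
      nothing-between L (∈ideals⁻ L∈) (⊊ᵇ-sound K L (∧-elimˡ K⊂L⊂I))
                                      (⊊ᵇ-sound L I (∧-elimʳ {⊊ᵇ P K L} K⊂L⊂I)))))

  remove-maximal-⋖ : ∀ x I → Ideal I → T⁻ P x I ≡ true → (I [ x ]≔ false) ⋖ I
  remove-maximal-⋖ x I ideal t⁻ = remove-maximal-ideal x {I} ideal t⁻ , (K⊆I , K≢I) , nothing-between
    where
    K : Subset n
    K = I [ x ]≔ false
    K⊆I : K ⊆ I
    K⊆I {y} y∈K with y ≟ x
    ... | yes refl = ⊥-elim (true≢false y∈K (lookup∘update x I false))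
    ... | no y≢x = trans (sym (lookup∘update′ y≢x I false)) y∈K
    K≢I : K ≢ I
    K≢I K≡I = true≢false (proj₁ (T⁻-sound x I t⁻))
                         (trans (cong (λ V → lookup V x) (sym K≡I)) (lookup∘update x I false))
    nothing-between : ∀ L → Ideal L → K ⊂ L → L ⊂ I → ⊥
    nothing-between L _ (K⊆L , K≢L) (L⊆I , L≢I) with lookup L x in x∈?L
    ... | true = L≢I (⊆-antisym L⊆I I⊆L)
      where
      I⊆L : I ⊆ L
      I⊆L {y} y∈I with y ≟ x
      ... | yes refl = x∈?L
      ... | no y≢x = K⊆L (trans (lookup∘update′ y≢x I false) y∈I)
    ... | false = K≢L (⊆-antisym K⊆L L⊆K)
      where
      L⊆K : L ⊆ K
      L⊆K {y} y∈L with y ≟ x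
      ... | yes refl = ⊥-elim (true≢false y∈L x∈?L)
      ... | no y≢x = trans (lookup∘update′ y≢x I false) (L⊆I y∈L)

  ⊂-witness : ∀ {K I} → K ⊂ I → ∃[ x ] (lookup I x ∧ not (lookup K x)) ≡ true
  ⊂-witness {K} {I} (K⊆I , K≢I) with anyP P (λ x → lookup I x ∧ not (lookup K x)) in found
  ... | true = anyP-sound found
  ... | false = ⊥-elim (K≢I (⊆-antisym K⊆I I⊆K))
    where
    I⊆K : I ⊆ K
    I⊆K {x} x∈I = ≢false⇒true λ x∉K → true≢false (anyP-complete x (∧-intro x∈I (not-intro x∉K))) found

  -- A minimal element m of I ∖ K can be added to K; covering forces K ∪ {m} = I.
  ⋖⇒remove-maximal : ∀ K I → Ideal I → K ⋖ I → ∃[ m ] T⁻ P m I ≡ true × K ≡ I [ m ]≔ false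
  ⋖⇒remove-maximal K I idealI (idealK , K⊂I@(K⊆I , _) , nothing-between)
    with ⊂-witness K⊂I
  ... | x , dx with minimal (λ x → lookup I x ∧ not (lookup K x)) x dx
  ... | m , dm , min = m , m-maximal , lookup-ext K≗I[m]≔false
    where
    m∈I : m ∈ₛ I
    m∈I = ∧-elimˡ dm
    m∉K : lookup K m ≡ false
    m∉K = not-elim (∧-elimʳ {lookup I m} dm)
    L : Subset n
    L = K [ m ]≔ true
    idealL : Ideal L
    idealL = add-minimal-ideal m {K} idealK
      (T⁺-complete m K m∉K λ {z} z<m → ≢false⇒true λ z∉K →
        true≢false (∧-intro (closed idealI m∈I (<⇒≤ z<m)) (not-intro z∉K)) (min z z<m))
    K⊆L : K ⊆ L
    K⊆L {y} y∈K with y ≟ m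
    ... | yes refl = lookup∘update m K true
    ... | no y≢m = trans (lookup∘update′ y≢m K true) y∈K
    L⊆I : L ⊆ I
    L⊆I {y} y∈L with y ≟ m
    ... | yes refl = m∈I
    ... | no y≢m = K⊆I (trans (sym (lookup∘update′ y≢m K true)) y∈L)
    L≡I : L ≡ I
    L≡I with vec-≡-dec _≟ᵇ_ L I
    ... | yes L≡I = L≡I
    ... | no L≢I = ⊥-elim (nothing-between L idealL (K⊆L , λ K≡L → true≢false (lookup∘update m K true)
                                                        (trans (cong (λ V → lookup V m) (sym K≡L)) m∉K))
                                                (L⊆I , L≢I))
    K≗I[m]≔false : ∀ y → lookup K y ≡ lookup (I [ m ]≔ false) y
    K≗I[m]≔false y with y ≟ m
    ... | yes refl = trans m∉K (sym (lookup∘update m I false))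
    ... | no y≢m = trans (sym (lookup∘update′ y≢m K true))
                         (trans (cong (λ V → lookup V y) L≡I) (sym (lookup∘update′ y≢m I false)))
    m-maximal : T⁻ P m I ≡ true
    m-maximal = T⁻-complete m I m∈I λ {z} (m≤z , m≢z) → ≢true⇒false λ z∈I →
      let z∈K = trans (sym (lookup∘update′ (m≢z ∘ sym) K true)) (trans (cong (λ V → lookup V z) L≡I) z∈I) in
      true≢false (closed idealK z∈K m≤z) m∉K

  χ-≢true : ∀ {a} → a ≢ true → χ a ≡ 0
  χ-≢true = cong χ ∘ ≢true⇒false

  ∑-ideals-point : ∀ S → Ideal S → (g : Subset n → ℕ) → ∑[ K ← ideals P ] (χ (S ≡ᵇ K) * g K) ≡ g S
  ∑-ideals-point S idealS g =
    trans (∑-point (λ K → χ (S ≡ᵇ K) * g K) ideals-unique (∈ideals⁺ {S} idealS)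
                   λ _ K≢S → cong (_* g _) (χ-≢true (K≢S ∘ sym ∘ ≡ᵇ-sound)))
          (trans (cong (λ b → χ b * g S) (≡ᵇ-complete {V = S} refl)) (ℕₚ.*-identityˡ (g S)))

  removes : Subset n → Fin n → Subset n → Bool
  removes I x K = T⁻ P x I ∧ ((I [ x ]≔ false) ≡ᵇ K)

  ∑-removes-⋖ : ∀ K I → Ideal I → K ⋖ I → ∑[ x ← List.allFin n ] χ (removes I x K) ≡ 1
  ∑-removes-⋖ K I idealI K⋖I with ⋖⇒remove-maximal K I idealI K⋖I
  ... | m , t⁻ , K≡I[m]≔false =
    trans (∑-point (λ x → χ (removes I x K)) (Uniqueₚ.allFin⁺ n) (∈-allFin m) other-removals)
          (cong χ (∧-intro t⁻ (≡ᵇ-complete (sym K≡I[m]≔false))))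
    where
    other-removals : ∀ {x} → x ∈ List.allFin n → x ≢ m → χ (removes I x K) ≡ 0
    other-removals {x} _ x≢m = χ-≢true {removes I x K} λ e → true≢false
      (trans (lookup∘update′ (x≢m ∘ sym) I false) (proj₁ (T⁻-sound m I t⁻)))
      (trans (cong (λ V → lookup V m) (trans (≡ᵇ-sound (∧-elimʳ {T⁻ P x I} e)) K≡I[m]≔false))
             (lookup∘update m I false))

  ∑-removes-¬⋖ : ∀ K I → Ideal I → coversJ P K I ≡ false → ∑[ x ← List.allFin n ] χ (removes I x K) ≡ 0
  ∑-removes-¬⋖ K I idealI ¬K⋖I = ∑-zero (List.allFin n) {λ x → χ (removes I x K)} λ {x} _ →
    χ-≢true {removes I x K} λ e → true≢false
      (coversJ-complete K I (subst (_⋖ I) (≡ᵇ-sound (∧-elimʳ {T⁻ P x I} e))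
                                          (remove-maximal-⋖ x I idealI (∧-elimˡ e))))
      ¬K⋖I

  χ-coversJ : ∀ K I → Ideal I → χ (coversJ P K I) ≡ ∑[ x ← List.allFin n ] χ (removes I x K)
  χ-coversJ K I idealI with coversJ P K I in K⋖I
  ... | true = sym (∑-removes-⋖ K I idealI (coversJ-sound K I K⋖I))
  ... | false = sym (∑-removes-¬⋖ K I idealI K⋖I)

  ddeg≡antichainCard : ∀ I → Ideal I → ddeg P I ≡ antichainCard P I
  ddeg≡antichainCard I idealI = begin
    ddeg P I
      ≡⟨ length-filterᵇ (λ K → coversJ P K I) (ideals P) ⟩
    ∑[ K ← ideals P ] χ (coversJ P K I)
      ≡⟨ ∑-cong (ideals P) (λ {K} _ → χ-coversJ K I idealI) ⟩
    ∑[ K ← ideals P ] ∑[ x ← List.allFin n ] χ (removes I x K)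
      ≡⟨ ∑-swap (ideals P) (List.allFin n) (λ K x → χ (removes I x K)) ⟩
    ∑[ x ← List.allFin n ] ∑[ K ← ideals P ] χ (removes I x K)
      ≡⟨ ∑-cong (List.allFin n) (λ {x} _ → removals-of x) ⟩
    ∑[ x ← List.allFin n ] χ (T⁻ P x I)
      ≡⟨ sym (length-filterᵇ (λ x → T⁻ P x I) (List.allFin n)) ⟩
    antichainCard P I ∎
    where
    open ≡-Reasoning
    removals-of : ∀ x → ∑[ K ← ideals P ] χ (removes I x K) ≡ χ (T⁻ P x I)
    removals-of x with T⁻ P x I in t⁻
    ... | false = ∑-zero (ideals P) (λ _ → refl)
    ... | true = trans (∑-cong (ideals P) λ _ → sym (ℕₚ.*-identityʳ _))
                       (∑-ideals-point (I [ x ]≔ false) (remove-maximal-ideal x {I} idealI t⁻) (λ _ → 1))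

  -- Rowmotion

  ∈row⁻ : ∀ I {x} → x ∈ₛ row P I → ∃[ y ] T⁺ P y I ≡ true × x ≤ y
  ∈row⁻ I {x} x∈ with anyP-sound (trans (sym (lookup∘tabulate _ x)) x∈)
  ... | y , e = y , ∧-elimˡ e , leqᵇ-sound (∧-elimʳ {T⁺ P y I} e)

  ∈row⁺ : ∀ I {x y} → T⁺ P y I ≡ true → x ≤ y → x ∈ₛ row P I
  ∈row⁺ I {x} {y} t⁺ x≤y = trans (lookup∘tabulate _ x) (anyP-complete y (∧-intro t⁺ (leqᵇ-complete x≤y)))

  row-ideal : ∀ I → Ideal (row P I)
  row-ideal I = downClosed λ y∈ x≤y → let z , t⁺ , y≤z = ∈row⁻ I y∈ in ∈row⁺ I t⁺ (≤-trans x≤y y≤z)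

  T⁻∘row : ∀ p I → T⁻ P p (row P I) ≡ T⁺ P p I
  T⁻∘row p I = ≡true-ext maximal⇒minimal minimal⇒maximal
    where
    maximal⇒minimal : T⁻ P p (row P I) ≡ true → T⁺ P p I ≡ true
    maximal⇒minimal t⁻ with T⁻-sound p (row P I) t⁻
    ... | p∈ , above with ∈row⁻ I p∈
    ... | y , t⁺ , p≤y with p ≟ y
    ... | yes refl = t⁺
    ... | no p≢y = ⊥-elim (true≢false (∈row⁺ I t⁺ ≤-refl) (above (p≤y , p≢y)))
    minimal⇒maximal : T⁺ P p I ≡ true → T⁻ P p (row P I) ≡ true
    minimal⇒maximal t⁺ = T⁻-complete p (row P I) (∈row⁺ I t⁺ ≤-refl) λ p<z → ≢true⇒false λ z∈ →
      let y , t⁺y , z≤y = ∈row⁻ I z∈ in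
      true≢false (proj₂ (T⁺-sound y I t⁺y) (<-≤-trans p<z z≤y)) (proj₁ (T⁺-sound p I t⁺))

  -- Uniform distributions on orbits

  PreservesIdeals : (Subset n → Subset n) → Set
  PreservesIdeals Φ = ∀ {I} → Ideal I → Ideal (Φ I)

  iter-ideal : ∀ {Φ} → PreservesIdeals Φ → ∀ {I} → Ideal I → ∀ t → Ideal (iter Φ t I)
  iter-ideal preserves idealI zero = idealI
  iter-ideal preserves idealI (suc t) = preserves (iter-ideal preserves idealI t)

  OrbitsToggleBalanced : (Subset n → Subset n) → Set
  OrbitsToggleBalanced Φ = ∀ I → Ideal I → ∀ k → iter Φ (suc k) I ≡ I → ∀ p →
    ∑[ t < suc k ] χ (T⁺ P p (iter Φ t I)) ≡ ∑[ t < suc k ] χ (T⁻ P p (iter Φ t I))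

  module OrbitDistribution {Φ} (preserves : PreservesIdeals Φ) {I} (idealI : Ideal I) (k : ℕ) where

    multiplicity : Subset n → ℕ
    multiplicity J = ∑[ t < suc k ] χ (iter Φ t I ≡ᵇ J)

    μ : Subset n → ℚ
    μ J = 1/[1+ k ] ℚ.* ℕtoℚ (multiplicity J)

    ∑-multiplicity : ∀ (g : Subset n → ℕ) →
                     ∑[ J ← ideals P ] (multiplicity J * g J) ≡ ∑[ t < suc k ] g (iter Φ t I)
    ∑-multiplicity g = begin
      ∑[ J ← ideals P ] (multiplicity J * g J)
        ≡⟨ ∑-cong (ideals P) (λ {J} _ → ∑<-distribʳ-* (suc k) (λ t → χ (iter Φ t I ≡ᵇ J)) (g J)) ⟩
      ∑[ J ← ideals P ] ∑[ t < suc k ] (χ (iter Φ t I ≡ᵇ J) * g J)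
        ≡⟨ sym (∑<-swap-∑ (suc k) (ideals P) (λ t J → χ (iter Φ t I ≡ᵇ J) * g J)) ⟩
      ∑[ t < suc k ] ∑[ J ← ideals P ] (χ (iter Φ t I ≡ᵇ J) * g J)
        ≡⟨ ∑<-cong (suc k) (λ t → ∑-ideals-point (iter Φ t I) (iter-ideal preserves idealI t) g) ⟩
      ∑[ t < suc k ] g (iter Φ t I) ∎
      where open ≡-Reasoning

    μ-weight : ∀ (g : Subset n → ℕ) J → μ J ℚ.* ℕtoℚ (g J) ≡ 1/[1+ k ] ℚ.* ℕtoℚ (multiplicity J * g J)
    μ-weight g J = trans (ℚₚ.*-assoc 1/[1+ k ] (ℕtoℚ (multiplicity J)) (ℕtoℚ (g J)))
                         (cong (1/[1+ k ] ℚ.*_) (sym (ℕtoℚ-* (multiplicity J) (g J))))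

    E-μ : ∀ (g : Subset n → ℕ) → E P μ (ℕtoℚ ∘ g) ≡ 1/[1+ k ] ℚ.* ℕtoℚ (∑[ t < suc k ] g (iter Φ t I))
    E-μ g = begin
      E P μ (ℕtoℚ ∘ g)
        ≡⟨ cong sumℚ (Listₚ.map-cong (μ-weight g) (ideals P)) ⟩
      sumℚ (List.map (λ J → 1/[1+ k ] ℚ.* ℕtoℚ (multiplicity J * g J)) (ideals P))
        ≡⟨ sumℚ-scaled-ℕtoℚ (ideals P) 1/[1+ k ] (λ J → multiplicity J * g J) ⟩
      1/[1+ k ] ℚ.* ℕtoℚ (∑[ J ← ideals P ] (multiplicity J * g J))
        ≡⟨ cong (λ m → 1/[1+ k ] ℚ.* ℕtoℚ m) (∑-multiplicity g) ⟩
      1/[1+ k ] ℚ.* ℕtoℚ (∑[ t < suc k ] g (iter Φ t I)) ∎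
      where open ≡-Reasoning

    E-μ-𝟙 : ∀ (b : Subset n → Bool) →
            E P μ (𝟙 ∘ b) ≡ 1/[1+ k ] ℚ.* ℕtoℚ (∑[ t < suc k ] χ (b (iter Φ t I)))
    E-μ-𝟙 b = trans (cong sumℚ (Listₚ.map-cong (λ J → cong (μ J ℚ.*_) (𝟙≡ℕtoℚ∘χ (b J))) (ideals P)))
                    (E-μ (χ ∘ b))

    μ-isDistribution : IsDistribution P μ
    μ-isDistribution = (λ J → 1/[1+]-*-ℕtoℚ-nonNeg k (multiplicity J))
                     , (λ J non-ideal → trans (cong (λ m → 1/[1+ k ] ℚ.* ℕtoℚ m)
                                                    (∑<-zero (suc k) _ (off-orbit non-ideal)))
                                              (ℚₚ.*-zeroʳ 1/[1+ k ]))
                     , total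
      where
      off-orbit : ∀ {J} → isIdeal P J ≡ false → ∀ t → χ (iter Φ t I ≡ᵇ J) ≡ 0
      off-orbit non-ideal t = χ-≢true λ e → true≢false
        (subst (λ J → isIdeal P J ≡ true) (≡ᵇ-sound e) (isIdeal-complete {iter Φ t I} (iter-ideal preserves idealI t)))
        non-ideal
      total : sumℚ (List.map μ (ideals P)) ≡ 1ℚ
      total = begin
        sumℚ (List.map μ (ideals P))
          ≡⟨ cong sumℚ (Listₚ.map-cong (λ J → sym (ℚₚ.*-identityʳ (μ J))) (ideals P)) ⟩
        E P μ (λ _ → ℕtoℚ 1)
          ≡⟨ E-μ (λ _ → 1) ⟩
        1/[1+ k ] ℚ.* ℕtoℚ (∑[ t < suc k ] 1)
          ≡⟨ cong (λ m → 1/[1+ k ] ℚ.* ℕtoℚ m) (∑<-const-1 (suc k)) ⟩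
        1/[1+ k ] ℚ.* ℕtoℚ (suc k)
          ≡⟨ 1/[1+]-*-ℕtoℚ k ⟩
        1ℚ ∎
        where open ≡-Reasoning

    μ-toggleSymmetric : (∀ p → ∑[ t < suc k ] χ (T⁺ P p (iter Φ t I)) ≡ ∑[ t < suc k ] χ (T⁻ P p (iter Φ t I))) →
                        ToggleSymmetric P μ
    μ-toggleSymmetric balanced p = begin
      E P μ (𝟙 ∘ T⁺ P p)                                            ≡⟨ E-μ-𝟙 (T⁺ P p) ⟩
      1/[1+ k ] ℚ.* ℕtoℚ (∑[ t < suc k ] χ (T⁺ P p (iter Φ t I)))
        ≡⟨ cong (λ m → 1/[1+ k ] ℚ.* ℕtoℚ m) (balanced p) ⟩
      1/[1+ k ] ℚ.* ℕtoℚ (∑[ t < suc k ] χ (T⁻ P p (iter Φ t I)))  ≡⟨ sym (E-μ-𝟙 (T⁻ P p)) ⟩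
      E P μ (𝟙 ∘ T⁻ P p)                                            ∎
      where open ≡-Reasoning

  mesic-antichainCard : ∀ {c Φ} → tCDE P c → PreservesIdeals Φ → OrbitsToggleBalanced Φ →
                        Mesic P (antichainCard P) Φ c
  mesic-antichainCard {c} {Φ} (expectedDdeg , _) preserves balanced I isIdealI k periodic _ = begin
    sumℚ (List.map (ℕtoℚ ∘ λ j → antichainCard P (iter Φ j I)) (List.upTo (suc k))) ℚ.* 1/[1+ k ]
      ≡⟨ cong (ℚ._* 1/[1+ k ]) (sumℚ-ℕtoℚ (List.upTo (suc k)) (λ j → antichainCard P (iter Φ j I))) ⟩
    ℕtoℚ (∑[ j ← List.upTo (suc k) ] antichainCard P (iter Φ j I)) ℚ.* 1/[1+ k ]
      ≡⟨ ℚₚ.*-comm _ 1/[1+ k ] ⟩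
    1/[1+ k ] ℚ.* ℕtoℚ (∑[ j ← List.upTo (suc k) ] antichainCard P (iter Φ j I))
      ≡⟨ cong (λ m → 1/[1+ k ] ℚ.* ℕtoℚ m) orbitTotal ⟩
    1/[1+ k ] ℚ.* ℕtoℚ (∑[ t < suc k ] ddeg P (iter Φ t I))
      ≡⟨ sym (E-μ (ddeg P)) ⟩
    E P μ (ℕtoℚ ∘ ddeg P)
      ≡⟨ expectedDdeg μ μ-isDistribution (μ-toggleSymmetric (balanced I idealI k periodic)) ⟩
    c ∎
    where
    open ≡-Reasoning
    idealI : Ideal I
    idealI = isIdeal-sound {I} isIdealI
    open OrbitDistribution preserves idealI k
    orbitTotal : ∑[ j ← List.upTo (suc k) ] antichainCard P (iter Φ j I) ≡ ∑[ t < suc k ] ddeg P (iter Φ t I)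
    orbitTotal = trans (∑-upTo (suc k) (λ j → antichainCard P (iter Φ j I)))
                       (∑<-cong (suc k) λ t → sym (ddeg≡antichainCard (iter Φ t I) (iter-ideal preserves idealI t)))

  row-balanced : OrbitsToggleBalanced (row P)
  row-balanced I _ k periodic p = begin
    ∑[ t < suc k ] χ (T⁺ P p (iter (row P) t I))
      ≡⟨ ∑<-cong (suc k) (λ t → cong χ (sym (T⁻∘row p (iter (row P) t I)))) ⟩
    ∑[ t < suc k ] χ (T⁻ P p (iter (row P) (suc t) I))
      ≡⟨ ∑<-rotate k (λ t → χ (T⁻ P p (iter (row P) t I))) (cong (χ ∘ T⁻ P p) periodic) ⟩
    ∑[ t < suc k ] χ (T⁻ P p (iter (row P) t I)) ∎
    where open ≡-Reasoning

  -- Locality of toggles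

  belowIn aboveOut : Fin n → Subset n → Bool
  belowIn p X = allP P (λ z → not (ltᵇ P z p) ∨ lookup X z)
  aboveOut p X = allP P (λ z → not (ltᵇ P p z) ∨ not (lookup X z))

  AgreeOnLowerCovers AgreeOnUpperCovers : Fin n → Subset n → Subset n → Set
  AgreeOnLowerCovers p X Y = ∀ {c} → CoversP P c p → lookup X c ≡ lookup Y c
  AgreeOnUpperCovers p X Y = ∀ {c} → CoversP P p c → lookup X c ≡ lookup Y c

  -- In an ideal, everything below p is in X as soon as the lower covers of p are.
  belowIn-local : ∀ p {X Y} → Ideal X → Ideal Y → AgreeOnLowerCovers p X Y → belowIn p X ≡ belowIn p Y
  belowIn-local p {X} {Y} idealX idealY agree = ≡true-ext (transfer {X} idealY agree) (transfer {Y} idealX (sym ∘ agree))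
    where
    transfer : ∀ {U V} → Ideal V → AgreeOnLowerCovers p U V → belowIn p U ≡ true → belowIn p V ≡ true
    transfer {U} {V} idealV agreeUV e = allP-complete λ z → ⇒ᵇ-intro λ z<p →
      let c , z≤c , c⋖p = lowerCover (ltᵇ-sound z<p) in
      closed idealV (trans (sym (agreeUV c⋖p)) (⇒ᵇ-elim (allP-sound e c) (ltᵇ-complete (proj₁ c⋖p)))) z≤c

  aboveOut-local : ∀ p {X Y} → Ideal X → Ideal Y → AgreeOnUpperCovers p X Y → aboveOut p X ≡ aboveOut p Y
  aboveOut-local p {X} {Y} idealX idealY agree = ≡true-ext (transfer {X} idealY agree) (transfer {Y} idealX (sym ∘ agree))
    where
    transfer : ∀ {U V} → Ideal V → AgreeOnUpperCovers p U V → aboveOut p U ≡ true → aboveOut p V ≡ true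
    transfer {U} {V} idealV agreeUV e = allP-complete λ z → ⇒ᵇ-intro λ p<z →
      let c , p⋖c , c≤z = upperCover (ltᵇ-sound p<z) in
      not-intro (≢true⇒false λ z∈V → true≢false (trans (agreeUV p⋖c) (closed idealV z∈V c≤z))
                                                 (not-elim (⇒ᵇ-elim (allP-sound e c) (ltᵇ-complete (proj₁ p⋖c)))))

  χ-T⁺+χ-∈≡χ-belowIn : ∀ p {X} → Ideal X → χ (T⁺ P p X) + χ (lookup X p) ≡ χ (belowIn p X)
  χ-T⁺+χ-∈≡χ-belowIn p {X} idealX with lookup X p in p∈?X | belowIn p X in below
  ... | false | b = ℕₚ.+-identityʳ (χ b)
  ... | true | true = refl
  ... | true | false = ⊥-elim (true≢false (allP-complete λ z → ⇒ᵇ-intro λ z<p →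
                                             closed idealX p∈?X (<⇒≤ (ltᵇ-sound z<p))) below)

  χ-T⁻+χ-∉≡χ-aboveOut : ∀ p {X} → Ideal X → χ (T⁻ P p X) + χ (not (lookup X p)) ≡ χ (aboveOut p X)
  χ-T⁻+χ-∉≡χ-aboveOut p {X} idealX with lookup X p in p∈?X | aboveOut p X in above
  ... | true | b = ℕₚ.+-identityʳ (χ b)
  ... | false | true = refl
  ... | false | false = ⊥-elim (true≢false (allP-complete λ z → ⇒ᵇ-intro λ p<z → not-intro (≢true⇒false λ z∈X →
                                   true≢false (closed idealX z∈X (<⇒≤ (ltᵇ-sound p<z))) p∈?X)) above)

  toggle-local : ∀ p {X Y} → Ideal X → Ideal Y → lookup X p ≡ lookup Y p →
                 AgreeOnLowerCovers p X Y → AgreeOnUpperCovers p X Y →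
                 lookup (toggle P p X) p ≡ lookup (toggle P p Y) p
  toggle-local p {X} {Y} idealX idealY same lower upper = begin
    lookup (toggle P p X) p
      ≡⟨ toggle-lookup-self p X ⟩
    (if T⁺ P p X then true else if T⁻ P p X then false else lookup X p)
      ≡⟨ cong₂ (λ a → if a then true else_) T⁺-same (cong₂ (λ b → if b then false else_) T⁻-same same) ⟩
    (if T⁺ P p Y then true else if T⁻ P p Y then false else lookup Y p)
      ≡⟨ sym (toggle-lookup-self p Y) ⟩
    lookup (toggle P p Y) p ∎
    where
    open ≡-Reasoning
    T⁺-same : T⁺ P p X ≡ T⁺ P p Y
    T⁺-same = cong₂ (λ s b → not s ∧ b) same (belowIn-local p idealX idealY lower)
    T⁻-same : T⁻ P p X ≡ T⁻ P p Y
    T⁻-same = cong₂ _∧_ same (aboveOut-local p idealX idealY upper)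

  -- Maps toggling each element once

  -- [before X] is the state at which Φ toggles p while computing Φ X.
  record TogglesOnce (Φ : Subset n → Subset n) (p : Fin n) : Set where
    field
      before : Subset n → Subset n
      before-ideal : ∀ {X} → Ideal X → Ideal (before X)
      before-at-p : ∀ X → lookup (before X) p ≡ lookup X p
      after-at-p : ∀ {X} → Ideal X → lookup (Φ X) p ≡ lookup (toggle P p (before X)) p
      lowerCovers : (∀ X → AgreeOnLowerCovers p (before X) X) ⊎ (∀ X → AgreeOnLowerCovers p (before X) (Φ X))
      upperCovers : (∀ X → AgreeOnUpperCovers p (before X) X) ⊎ (∀ X → AgreeOnUpperCovers p (before X) (Φ X))

  module _ {Φ} (preserves : PreservesIdeals Φ) {I} (idealI : Ideal I) (k : ℕ) (periodic : iter Φ (suc k) I ≡ I)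
           {p} (once : TogglesOnce Φ p) where

    open TogglesOnce once

    private
      orbit : ℕ → Subset n
      orbit t = iter Φ t I

      Σorbit Σbefore : (Subset n → ℕ) → ℕ
      Σorbit g = ∑[ t < suc k ] g (orbit t)
      Σbefore g = ∑[ t < suc k ] g (before (orbit t))

      orbit-ideal : ∀ t → Ideal (orbit t)
      orbit-ideal = iter-ideal preserves idealI

    -- Agreement with X or with Φ X gives the same total, the latter after one rotation of the orbit.
    Σbefore≡Σorbit : ∀ g → (∀ {X} → Ideal X → g (before X) ≡ g X) ⊎
                           (∀ {X} → Ideal X → g (before X) ≡ g (Φ X)) →
                     Σbefore g ≡ Σorbit g
    Σbefore≡Σorbit g (inj₁ same) = ∑<-cong (suc k) (λ t → same (orbit-ideal t))
    Σbefore≡Σorbit g (inj₂ next) =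
      trans (∑<-cong (suc k) (λ t → next (orbit-ideal t))) (∑<-rotate k (g ∘ orbit) (cong g periodic))

    Σbefore≡Σorbit-via : ∀ f s h → (∀ {X} → Ideal X → f X + s X ≡ h X) →
                         Σbefore s ≡ Σorbit s → Σbefore h ≡ Σorbit h → Σbefore f ≡ Σorbit f
    Σbefore≡Σorbit-via f s h f+s≡h s-same h-same = ℕₚ.+-cancelʳ-≡ (Σorbit s) _ _ (begin
      Σbefore f + Σorbit s                          ≡⟨ cong (Σbefore f +_) (sym s-same) ⟩
      Σbefore f + Σbefore s
        ≡⟨ sym (∑<-distrib-+ (suc k) (f ∘ before ∘ orbit) (s ∘ before ∘ orbit)) ⟩
      ∑[ t < suc k ] (f (before (orbit t)) + s (before (orbit t)))
        ≡⟨ ∑<-cong (suc k) (λ t → f+s≡h (before-ideal (orbit-ideal t))) ⟩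
      Σbefore h                                     ≡⟨ h-same ⟩
      Σorbit h                                      ≡⟨ sym (∑<-cong (suc k) (λ t → f+s≡h (orbit-ideal t))) ⟩
      ∑[ t < suc k ] (f (orbit t) + s (orbit t))    ≡⟨ ∑<-distrib-+ (suc k) (f ∘ orbit) (s ∘ orbit) ⟩
      Σorbit f + Σorbit s                           ∎)
      where open ≡-Reasoning

    Σbefore-T⁺ : Σbefore (χ ∘ T⁺ P p) ≡ Σorbit (χ ∘ T⁺ P p)
    Σbefore-T⁺ = Σbefore≡Σorbit-via (χ ∘ T⁺ P p) (λ X → χ (lookup X p)) (χ ∘ belowIn p)
      (χ-T⁺+χ-∈≡χ-belowIn p)
      (Σbefore≡Σorbit (λ X → χ (lookup X p)) (inj₁ λ {X} _ → cong χ (before-at-p X)))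
      (Σbefore≡Σorbit (χ ∘ belowIn p)
        (Sum.map (λ agree {X} idealX → cong χ (belowIn-local p (before-ideal idealX) idealX (agree X)))
                 (λ agree {X} idealX → cong χ (belowIn-local p (before-ideal idealX) (preserves idealX) (agree X)))
                 lowerCovers))

    Σbefore-T⁻ : Σbefore (χ ∘ T⁻ P p) ≡ Σorbit (χ ∘ T⁻ P p)
    Σbefore-T⁻ = Σbefore≡Σorbit-via (χ ∘ T⁻ P p) (λ X → χ (not (lookup X p))) (χ ∘ aboveOut p)
      (χ-T⁻+χ-∉≡χ-aboveOut p)
      (Σbefore≡Σorbit (λ X → χ (not (lookup X p))) (inj₁ λ {X} _ → cong (χ ∘ not) (before-at-p X)))
      (Σbefore≡Σorbit (χ ∘ aboveOut p)
        (Sum.map (λ agree {X} idealX → cong χ (aboveOut-local p (before-ideal idealX) idealX (agree X)))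
                 (λ agree {X} idealX → cong χ (aboveOut-local p (before-ideal idealX) (preserves idealX) (agree X)))
                 upperCovers))

    -- Over a whole period p enters and leaves equally often, and it moves only when toggled.
    Σbefore-T⁺≡Σbefore-T⁻ : Σbefore (χ ∘ T⁺ P p) ≡ Σbefore (χ ∘ T⁻ P p)
    Σbefore-T⁺≡Σbefore-T⁻ = sym (ℕₚ.+-cancelˡ-≡ (Σorbit member) _ _ (begin
      Σorbit member + Σbefore (χ ∘ T⁻ P p)
        ≡⟨ cong (_+ Σbefore (χ ∘ T⁻ P p)) (sym (∑<-rotate k (member ∘ orbit) (cong member periodic))) ⟩
      ∑[ t < suc k ] member (orbit (suc t)) + Σbefore (χ ∘ T⁻ P p)
        ≡⟨ sym (∑<-distrib-+ (suc k) (member ∘ orbit ∘ suc) (χ ∘ T⁻ P p ∘ before ∘ orbit)) ⟩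
      ∑[ t < suc k ] (member (orbit (suc t)) + χ (T⁻ P p (before (orbit t))))
        ≡⟨ ∑<-cong (suc k) (λ t → trans (cong (λ b → χ b + χ (T⁻ P p (before (orbit t))))
                                              (after-at-p (orbit-ideal t)))
                                        (toggle-count p (before (orbit t)))) ⟩
      ∑[ t < suc k ] (member (before (orbit t)) + χ (T⁺ P p (before (orbit t))))
        ≡⟨ ∑<-distrib-+ (suc k) (member ∘ before ∘ orbit) (χ ∘ T⁺ P p ∘ before ∘ orbit) ⟩
      Σbefore member + Σbefore (χ ∘ T⁺ P p)
        ≡⟨ cong (_+ Σbefore (χ ∘ T⁺ P p)) (∑<-cong (suc k) (λ t → cong χ (before-at-p (orbit t)))) ⟩
      Σorbit member + Σbefore (χ ∘ T⁺ P p) ∎))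
      where
      open ≡-Reasoning
      member : Subset n → ℕ
      member X = χ (lookup X p)

    togglesOnce-balanced : Σorbit (χ ∘ T⁺ P p) ≡ Σorbit (χ ∘ T⁻ P p)
    togglesOnce-balanced = trans (sym Σbefore-T⁺) (trans Σbefore-T⁺≡Σbefore-T⁻ Σbefore-T⁻)

  togglesOnce⇒balanced : ∀ {Φ} → PreservesIdeals Φ → (∀ p → TogglesOnce Φ p) → OrbitsToggleBalanced Φ
  togglesOnce⇒balanced preserves once I idealI k periodic p = togglesOnce-balanced preserves idealI k periodic (once p)

  -- Rank-by-rank toggling

  module Ranked (rk : Fin n → ℕ) (isRank : IsRankFunction P rk) where

    cover-rank : ∀ {c p} → CoversP P c p → rk p ≡ suc (rk c)
    cover-rank {c} {p} = proj₂ isRank c p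

    cover-rank-≢ : ∀ {c p} → CoversP P c p → rk c ≢ rk p
    cover-rank-≢ c⋖p rkc≡rkp = ℕₚ.1+n≢n (trans (sym (cover-rank c⋖p)) (sym rkc≡rkp))

    rankStep : ℕ → Fin n → Subset n → Subset n
    rankStep i q J = if ⌊ rk q ℕ.≟ i ⌋ then toggle P q J else J

    rankStep-ideal : ∀ i q {J} → Ideal J → Ideal (rankStep i q J)
    rankStep-ideal i q idealJ with rk q ℕ.≟ i
    ... | yes _ = toggle-ideal q idealJ
    ... | no _ = idealJ

    rankStep-frame : ∀ i q J {y} → (rk q ≡ i → y ≢ q) → lookup (rankStep i q J) y ≡ lookup J y
    rankStep-frame i q J untouched with rk q ℕ.≟ i
    ... | yes rkq≡i = toggle-lookup-other q J (untouched rkq≡i)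
    ... | no _ = refl

    rankSteps-frame : ∀ i xs X {y} → rk y ≢ i → lookup (List.foldr (rankStep i) X xs) y ≡ lookup X y
    rankSteps-frame i xs X rky≢i = lookup-foldr-frame (rankStep i) xs
      (λ {q} _ Z → rankStep-frame i q Z λ rkq≡i y≡q → rky≢i (trans (cong rk y≡q) rkq≡i)) X

    rankSteps-frame-∉ : ∀ i xs X {y} → y ∉ xs → lookup (List.foldr (rankStep i) X xs) y ≡ lookup X y
    rankSteps-frame-∉ i xs X y∉xs = lookup-foldr-frame (rankStep i) xs
      (λ {q} q∈ Z → rankStep-frame i q Z λ _ y≡q → y∉xs (subst (_∈ xs) (sym y≡q) q∈)) X

    τrank-ideal : ∀ i {Y} → Ideal Y → Ideal (τrank P rk i Y)
    τrank-ideal i idealY = foldr-preserves Ideal (rankStep-ideal i) idealY (List.allFin n)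

    τrank-frame : ∀ i Y {y} → rk y ≢ i → lookup (τrank P rk i Y) y ≡ lookup Y y
    τrank-frame i Y = rankSteps-frame i (List.allFin n) Y

    -- The covers of p have other ranks, so toggling the rest of rank i does not affect the toggle at p.
    τrank-self : ∀ {i p} → rk p ≡ i → ∀ {Y} → Ideal Y → lookup (τrank P rk i Y) p ≡ lookup (toggle P p Y) p
    τrank-self {i} {p} rkp≡i {Y} idealY with ∈-unique-split (Uniqueₚ.allFin⁺ n) (∈-allFin p)
    ... | pre , post , allFin≡ , p∉pre , p∉post , _ = begin
      lookup (List.foldr (rankStep i) Y (List.allFin n)) p
        ≡⟨ cong (λ xs → lookup (List.foldr (rankStep i) Y xs) p) allFin≡ ⟩
      lookup (List.foldr (rankStep i) Y (pre ++ p ∷ post)) p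
        ≡⟨ cong (λ V → lookup V p) (Listₚ.foldr-++ (rankStep i) Y pre (p ∷ post)) ⟩
      lookup (List.foldr (rankStep i) (rankStep i p Z) pre) p
        ≡⟨ rankSteps-frame-∉ i pre (rankStep i p Z) p∉pre ⟩
      lookup (rankStep i p Z) p
        ≡⟨ cong (λ V → lookup V p) rankStep-p ⟩
      lookup (toggle P p Z) p
        ≡⟨ toggle-local p idealZ idealY
             (rankSteps-frame-∉ i post Y p∉post)
             (λ c⋖p → rankSteps-frame i post Y λ rkc≡i → cover-rank-≢ c⋖p (trans rkc≡i (sym rkp≡i)))
             (λ p⋖c → rankSteps-frame i post Y λ rkc≡i → cover-rank-≢ p⋖c (trans rkp≡i (sym rkc≡i))) ⟩
      lookup (toggle P p Y) p ∎
      where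
      open ≡-Reasoning
      Z : Subset n
      Z = List.foldr (rankStep i) Y post
      idealZ : Ideal Z
      idealZ = foldr-preserves Ideal (rankStep-ideal i) idealY post
      rankStep-p : rankStep i p Z ≡ toggle P p Z
      rankStep-p with rk p ℕ.≟ i
      ... | yes _ = refl
      ... | no rkp≢i = ⊥-elim (rkp≢i rkp≡i)

    module RankPermuted (r : ℕ) (bounded : ∀ p → rk p ℕ.≤ r) (σ : Permutation′ (suc r)) where

      rankOf : Fin (suc r) → ℕ
      rankOf j = toℕ (σ ⟨$⟩ʳ j)

      rankOf-injective : ∀ {j j′} → rankOf j ≡ rankOf j′ → j ≡ j′
      rankOf-injective {j} {j′} e =
        trans (sym (inverseˡ σ)) (trans (cong (σ ⟨$⟩ˡ_) (toℕ-injective e)) (inverseˡ σ))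

      block : Fin (suc r) → Subset n → Subset n
      block j = τrank P rk (rankOf j)

      blockOf : Fin n → Fin (suc r)
      blockOf p = σ ⟨$⟩ˡ fromℕ< (ℕ.s≤s (bounded p))

      rankOf-blockOf : ∀ p → rankOf (blockOf p) ≡ rk p
      rankOf-blockOf p = trans (cong toℕ (inverseʳ σ)) (toℕ-fromℕ< (ℕ.s≤s (bounded p)))

      blocks-frame : ∀ js X {y} → (∀ {j} → j ∈ js → rankOf j ≢ rk y) →
                     lookup (List.foldr block X js) y ≡ lookup X y
      blocks-frame js X untouched = lookup-foldr-frame block js (λ j∈ Z → τrank-frame _ Z (untouched j∈ ∘ sym)) X

      blocks-ideal : ∀ js {X} → Ideal X → Ideal (List.foldr block X js)
      blocks-ideal js idealX = foldr-preserves Ideal (λ j → τrank-ideal (rankOf j)) idealX js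

      rowσ-ideal : PreservesIdeals (rowσ P rk r σ)
      rowσ-ideal = blocks-ideal (List.allFin (suc r))

      rowσ-togglesOnce : ∀ p → TogglesOnce (rowσ P rk r σ) p
      rowσ-togglesOnce p with ∈-unique-split (Uniqueₚ.allFin⁺ (suc r)) (∈-allFin (blockOf p))
      ... | pre , post , allFin≡ , j₀∉pre , j₀∉post , disjoint = record
        { before = before
        ; before-ideal = blocks-ideal post
        ; before-at-p = λ X → blocks-frame post X (λ j∈ → other-rank λ { refl → j₀∉post j∈ })
        ; after-at-p = after-at-p
        ; lowerCovers = lowerCovers
        ; upperCovers = Sum.map (λ agree X p⋖c → agree X (cover-rank p⋖c))
                                (λ agree X p⋖c → agree X (cover-rank p⋖c))
                                (rank-agreement (suc (rk p)) ℕₚ.1+n≢n)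
        }
        where
        open ≡-Reasoning
        j₀ : Fin (suc r)
        j₀ = blockOf p
        rankOf-j₀ : rankOf j₀ ≡ rk p
        rankOf-j₀ = rankOf-blockOf p

        other-rank : ∀ {j} → j ≢ j₀ → rankOf j ≢ rk p
        other-rank j≢j₀ e = j≢j₀ (rankOf-injective (trans e (sym rankOf-j₀)))

        before : Subset n → Subset n
        before X = List.foldr block X post

        rowσ-split : ∀ X → rowσ P rk r σ X ≡ List.foldr block (block j₀ (before X)) pre
        rowσ-split X = trans (cong (List.foldr block X) allFin≡) (Listₚ.foldr-++ block X pre (j₀ ∷ post))

        after-at-p : ∀ {X} → Ideal X → lookup (rowσ P rk r σ X) p ≡ lookup (toggle P p (before X)) p
        after-at-p {X} idealX = begin
          lookup (rowσ P rk r σ X) p                           ≡⟨ cong (λ V → lookup V p) (rowσ-split X) ⟩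
          lookup (List.foldr block (block j₀ (before X)) pre) p
            ≡⟨ blocks-frame pre _ (λ j∈ → other-rank λ { refl → j₀∉pre j∈ }) ⟩
          lookup (block j₀ (before X)) p
            ≡⟨ τrank-self (sym rankOf-j₀) (blocks-ideal post idealX) ⟩
          lookup (toggle P p (before X)) p                     ∎

        -- Whether the block of rank v runs before or after block j₀ decides the side [before X] agrees with.
        rank-agreement : ∀ v → v ≢ rk p →
          (∀ X {c} → rk c ≡ v → lookup (before X) c ≡ lookup X c) ⊎
          (∀ X {c} → rk c ≡ v → lookup (before X) c ≡ lookup (rowσ P rk r σ X) c)
        rank-agreement v v≢rkp with any? (λ j → rankOf j ℕ.≟ v) pre
        ... | yes found = let j₁ , j₁∈pre , rankOf-j₁ = find found in
          inj₁ λ X rkc≡v → blocks-frame post X λ j∈post rankOf-j≡rkc →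
            disjoint (j₁∈pre , subst (_∈ post) (rankOf-injective (trans rankOf-j≡rkc (trans rkc≡v (sym rankOf-j₁))))
                                     j∈post)
        ... | no none = inj₂ λ X {c} rkc≡v → sym (begin
          lookup (rowσ P rk r σ X) c                           ≡⟨ cong (λ V → lookup V c) (rowσ-split X) ⟩
          lookup (List.foldr block (block j₀ (before X)) pre) c
            ≡⟨ blocks-frame pre _ (λ j∈ rankOf-j≡rkc → none (lose j∈ (trans rankOf-j≡rkc rkc≡v))) ⟩
          lookup (block j₀ (before X)) c
            ≡⟨ τrank-frame (rankOf j₀) (before X) (λ e → v≢rkp (trans (sym rkc≡v) (trans e rankOf-j₀))) ⟩
          lookup (before X) c                                  ∎)

        lowerCovers : (∀ X → AgreeOnLowerCovers p (before X) X) ⊎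
                      (∀ X → AgreeOnLowerCovers p (before X) (rowσ P rk r σ X))
        lowerCovers = lowerCoversAtRank (rk p) refl
          where
          lowerCoversAtRank : ∀ w → rk p ≡ w →
            (∀ X → AgreeOnLowerCovers p (before X) X) ⊎ (∀ X → AgreeOnLowerCovers p (before X) (rowσ P rk r σ X))
          lowerCoversAtRank zero rkp = inj₁ λ X c⋖p → ⊥-elim (ℕₚ.0≢1+n (trans (sym rkp) (cover-rank c⋖p)))
          lowerCoversAtRank (suc v) rkp =
            Sum.map (λ agree X c⋖p → agree X (rank-below c⋖p)) (λ agree X c⋖p → agree X (rank-below c⋖p))
                    (rank-agreement v λ v≡ → ℕₚ.1+n≢n (trans (sym rkp) (sym v≡)))
            where
            rank-below : ∀ {c} → CoversP P c p → rk c ≡ v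
            rank-below c⋖p = ℕₚ.suc-injective (trans (sym (cover-rank c⋖p)) rkp)

open Poset using (mesic-antichainCard; row-ideal; row-balanced; togglesOnce⇒balanced)

corollary7p9 : (P : FinPoset) → Connected P → (c : ℚ) → tCDE P c →
    Mesic P (antichainCard P) (row P) c
    × ((rk : Fin (FinPoset.n P) → ℕ) → IsRankFunction P rk →
       (r : ℕ) → (∀ p → rk p ℕ.≤ r) → (∃ λ p → rk p ≡ r) →
       (σ : Permutation′ (suc r)) →
       Mesic P (antichainCard P) (rowσ P rk r σ) c)
corollary7p9 P _ c tcde =
  mesic-antichainCard P tcde (λ {I} _ → row-ideal P I) (row-balanced P) ,
  λ rk isRank r bounded _ σ →
    let open Poset.Ranked.RankPermuted P rk isRank r bounded σ in
    mesic-antichainCard P tcde rowσ-ideal (togglesOnce⇒balanced P rowσ-ideal rowσ-togglesOnce)
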